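{- Let $d,k \in \mathbb{N}$ and $\alpha \in \mathbb{R}$ with $\alpha\ge 0$. Let $\mathcal{H}_{d,\alpha}$ be the class of graphs with maximum degree at most $d$ that are not incidence $(d+(1+\alpha)k-1,\,(1+\alpha)k-1)$-colorable. If $G$ is a minimal graph in $\mathcal{H}_{d,\alpha}$ (no proper subgraph of $G$ lies in $\mathcal{H}_{d,\alpha}$), then every vertex $u \in V(G)$ with $d(u) \le k-1$ has more than $(1+\alpha)k-d(u)$ neighbors of degree at least $d-k+2$.
   Context: All graphs are simple and finite. An incidence of $G$ is a pair $(v,e)$ with $v$ a vertex and $e$ an edge incident to $v$. Two incidences $(u,e)$ and $(v,f)$ are adjacent if $u=v$, or $e=f$, or $uv=e$ or $uv=f$. An incidence coloring assigns colors to incidences so that adjacent incidences receive distinct colors. For a vertex $u$, a weak incidence of $u$ is an incidence $(v,vu)$ for a neighbor $v$ of $u$. An incidence $(k,\ell)$-coloring ($k,\ell$ possibly non-integer reals) is an incidence coloring with colors among the integers in $[1,k]$ such that for every vertex $u$, at most $\ell$ distinct colors appear on the weak incidences of $u$. $d(u)$ denotes the degree of $u$.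
   Formalization: The parameter α ranges over the non-negative rationals instead of the non-negative reals. -}

module Defs where

open import Data.Nat using (ℕ; zero; suc; _≤_; _<_; _≟_)
open import Data.Bool using (Bool; true; false; T)
open import Data.Fin using (Fin)
open import Data.List using (List; length; map; filterᵇ; deduplicate)
open import Data.Integer using (+_)
open import Data.Rational using (ℚ; 1ℚ; _/_; _+_; _*_; _-_) renaming (_≤_ to _≤ℚ_; _<_ to _<ℚ_)
open import Data.Product using (Σ; _×_; ∃; ∃-syntax)
open import Data.Sum using (_⊎_)
open import Relation.Binary.PropositionalEquality using (_≡_; _≢_)
open import Relation.Nullary using (¬_)
open import Function using (_∘_)
import Data.List as L
import Data.Fin as F
import Data.Nat as Nat

ℕ→ℚ : ℕ → ℚ
ℕ→ℚ n = + n / 1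

record Graph : Set where
  field
    n     : ℕ
    adj   : Fin n → Fin n → Bool
    sym   : ∀ u v → adj u v ≡ adj v u
    irrefl : ∀ u → adj u u ≡ false
open Graph public

Adj : (G : Graph) → Fin (n G) → Fin (n G) → Set
Adj G u v = T (adj G u v)

neighbours : (G : Graph) → Fin (n G) → List (Fin (n G))
neighbours G u = filterᵇ (adj G u) (L.allFin (n G))

degree : (G : Graph) → Fin (n G) → ℕ
degree G u = length (neighbours G u)

MaxDegreeAtMost : Graph → ℕ → Set
MaxDegreeAtMost G d = ∀ v → degree G v ≤ d

record Subgraph (H G : Graph) : Set where
  field
    f     : Fin (n H) → Fin (n G)
    inj   : ∀ x y → f x ≡ f y → x ≡ y
    edges : ∀ x y → Adj H x y → Adj G (f x) (f y)
open Subgraph public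

-- proper: H misses a vertex of G, or misses an edge of G between its vertices
-- (together with injectivity, not proper means H is all of G)
Proper : ∀ {H G} → Subgraph H G → Set
Proper {H} {G} s = (n H < n G) ⊎ (∃[ x ] ∃[ y ] (Adj G (f s x) (f s y) × ¬ Adj H x y))

-- An incidence (v, vw) is represented by the ordered pair (v , w) with v ~ w.
-- A colouring assigns a natural number c v w to every ordered pair; only the
-- values on adjacent pairs (incidences) matter.
Colouring : Graph → Set
Colouring G = Fin (n G) → Fin (n G) → ℕ

-- adjacency of incidences (u, uu') and (v, vv'):
-- u = v, or e = f (as edges {u,u'} = {v,v'}), or uv = e (v = u'), or uv = f (u = v')
IncAdjacent : (G : Graph) → (u u' v v' : Fin (n G)) → Set
IncAdjacent G u u' v v' =
  (u ≡ v) ⊎ (((u ≡ v) × (u' ≡ v')) ⊎ ((u ≡ v') × (u' ≡ v))) ⊎ (v ≡ u') ⊎ (u ≡ v')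

IsIncidenceColouring : (G : Graph) → Colouring G → Set
IsIncidenceColouring G c =
  ∀ u u' v v' → Adj G u u' → Adj G v v' → ¬ ((u ≡ v) × (u' ≡ v')) →
  IncAdjacent G u u' v v' → c u u' ≢ c v v'

-- colours of the weak incidences (v, vu) of u, v a neighbour of u
weakColours : (G : Graph) → Colouring G → Fin (n G) → List ℕ
weakColours G c u = map (λ v → c v u) (neighbours G u)

numWeakColours : (G : Graph) → Colouring G → Fin (n G) → ℕ
numWeakColours G c u = length (deduplicate _≟_ (weakColours G c u))

IsIncColouringKL : (G : Graph) → ℚ → ℚ → Colouring G → Set
IsIncColouringKL G k ℓ c =
  IsIncidenceColouring G c
  × (∀ u w → Adj G u w → (1 ≤ c u w) × (ℕ→ℚ (c u w) ≤ℚ k))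
  × (∀ u → ℕ→ℚ (numWeakColours G c u) ≤ℚ ℓ)

IncColourable : Graph → ℚ → ℚ → Set
IncColourable G k ℓ = ∃[ c ] IsIncColouringKL G k ℓ c

InH : ℕ → ℕ → ℚ → Graph → Set
InH d k α G =
  MaxDegreeAtMost G d
  × ¬ IncColourable G (ℕ→ℚ d + (1ℚ + α) * ℕ→ℚ k - 1ℚ) ((1ℚ + α) * ℕ→ℚ k - 1ℚ)

MinimalInH : ℕ → ℕ → ℚ → Graph → Set
MinimalInH d k α G =
  InH d k α G × (∀ (H : Graph) (s : Subgraph H G) → Proper s → ¬ InH d k α H)

-- number of neighbours v of u with d(v) ≥ d - k + 2 (i.e. d(v) + k ≥ d + 2)
numHighNeighbours : (G : Graph) → ℕ → ℕ → Fin (n G) → ℕ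
numHighNeighbours G d k u =
  length (filterᵇ (λ v → (d Nat.+ 2) Nat.≤ᵇ (degree G v Nat.+ k)) (neighbours G u))

-- Suppose d(u) = t < k and u has h ≤ (1+α)k − t neighbours of degree ≥ d − k + 2 ("high"), and
-- let ℓ = (1+α)k − 1. By minimality a proper subgraph of G is colourable; we extend its colouring to G.
-- If t = 0 we delete u, which carries no incidence. Otherwise we delete the edges at u and choose,
-- for every neighbour v, a colour b(v) for (v, vu) and a colour a(v) for (u, uv):
--   * a high v gets b(v) outside the d(v) − 1 strong and w(v) ≤ ℓ weak colours at v, so b(v) ≤ d + ℓ;
--   * the a(v) are distinct and avoid these h colours. A low v whose weak colours leave no room for a
--     new one takes one of them: there are at least t ≥ h + #(such v) of them. Any other v sees at most
--     h + t − 1 ≤ ℓ forbidden colours, so it takes a new colour below d(v) + h + t − 1 ≤ d + ℓ or, if its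
--     weak colours are full (then v is high, and b(v) is forbidden without being weak at v), one of those;
--   * a low v has d(v) + t ≤ d, so b(v) avoids the colours at v and all a's and stays ≤ d + w(v).
module Submission where

open import Defs hiding (sym)
open import Data.Bool using (Bool; false; T)
open import Data.Empty using (⊥; ⊥-elim)
open import Data.Fin as Fin using (Fin; punchIn; punchOut)
import Data.Fin.Properties as Fin
open import Data.Integer as ℤ using (+_)
import Data.Integer.Properties as ℤ
open import Data.List using (List; []; _∷_; length; map; filter; upTo; allFin; deduplicate; _++_)
open import Data.List.Properties
  using (length-filter; filter-notAll; length-map; length-upTo; length-++; length-deduplicate; ++-identityʳ)
open import Data.List.Membership.Propositional using (_∈_; _∉_; find; lose)
open import Data.List.Membership.Propositional.Properties
  using (∈-filter⁺; ∈-filter⁻; ∈-map⁺; ∈-map⁻; ∈-upTo⁻; ∈-allFin; ∈-length; ∈-++⁺ˡ; ∈-++⁺ʳ; ∈-deduplicate⁺; ∈-deduplicate⁻)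
open import Data.List.Relation.Binary.Subset.Propositional using (_⊆_)
open import Data.List.Relation.Unary.Any as Any using (here; there)
import Data.List.Relation.Unary.All as All
open import Data.List.Relation.Unary.Unique.Propositional using (Unique; _∷_)
import Data.List.Relation.Unary.Unique.Propositional.Properties as Unique
open import Data.List.Relation.Unary.Unique.DecPropositional.Properties using (deduplicate-!)
open import Data.Nat as ℕ using (ℕ; zero; suc; _≤_; _<_; z≤n; s≤s)
import Data.Nat.Coprimality as Coprime
import Data.Nat.Properties as ℕ
open import Data.List.Membership.DecPropositional ℕ._≟_ using (_∈?_)
open import Data.Product using (∃-syntax; _×_; _,_; proj₁; proj₂)
open import Data.Rational as ℚ
  using (ℚ; 0ℚ; 1ℚ; _+_; _*_; _-_; -_; mkℚ; *≤*; NonNegative; nonNegative) renaming (_≤_ to _≤ℚ_; _<_ to _<ℚ_)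
open import Data.Rational.Properties
  using ( normalize-coprime; ≤-trans; ≮⇒≥; +-monoˡ-≤; +-monoʳ-≤; +-assoc; +-identityʳ; *-identityˡ; *-zeroˡ
        ; *-distribʳ-+; *-monoʳ-≤-nonNeg; module ≤-Reasoning; +-0-group; _<?_)
  renaming (_≤?_ to _≤ℚ?_)
open import Algebra.Properties.Group +-0-group using (//-rightDividesˡ; //-rightDividesʳ)
open import Data.Sum using (_⊎_; inj₁; inj₂; [_,_]′)
open import Function using (_∘_; id)
open import Level using (0ℓ)
open import Relation.Binary.Definitions using (DecidableEquality)
open import Relation.Binary.PropositionalEquality
open import Relation.Nullary using (¬_; Dec; yes; no; ¬?)
open import Relation.Nullary.Decidable using (T?; _×-dec_; decidable-stable)
open import Relation.Unary using (Pred; Decidable)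

ℕ→ℚ-≡-mkℚ : ∀ m → ℕ→ℚ m ≡ mkℚ (+ m) 0 (Coprime.sym (Coprime.1-coprimeTo m))
ℕ→ℚ-≡-mkℚ m = normalize-coprime (Coprime.sym (Coprime.1-coprimeTo m))

ℕ→ℚ-mono-≤ : ∀ {m o} → m ≤ o → ℕ→ℚ m ≤ℚ ℕ→ℚ o
ℕ→ℚ-mono-≤ {m} {o} m≤o rewrite ℕ→ℚ-≡-mkℚ m | ℕ→ℚ-≡-mkℚ o =
  *≤* (subst₂ ℤ._≤_ (sym (ℤ.*-identityʳ (+ m))) (sym (ℤ.*-identityʳ (+ o))) (ℤ.+≤+ m≤o))

ℕ→ℚ-homo-+ : ∀ m o → ℕ→ℚ (m ℕ.+ o) ≡ ℕ→ℚ m + ℕ→ℚ o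
ℕ→ℚ-homo-+ m o rewrite ℕ→ℚ-≡-mkℚ m | ℕ→ℚ-≡-mkℚ o =
  cong (ℚ._/ 1) (sym (cong₂ ℤ._+_ (ℤ.*-identityʳ (+ m)) (ℤ.*-identityʳ (+ o))))

ℕ→ℚ-suc : ∀ m → ℕ→ℚ (suc m) ≡ ℕ→ℚ m + 1ℚ
ℕ→ℚ-suc m = trans (cong ℕ→ℚ (ℕ.+-comm 1 m)) (ℕ→ℚ-homo-+ m 1)

p≤r-q⇒p+q≤r : ∀ {p q r} → p ≤ℚ r - q → p + q ≤ℚ r
p≤r-q⇒p+q≤r {p} {q} {r} p≤r-q = subst (p + q ≤ℚ_) (//-rightDividesˡ q r) (+-monoˡ-≤ q p≤r-q)

p+q≤r⇒p≤r-q : ∀ {p q r} → p + q ≤ℚ r → p ≤ℚ r - q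
p+q≤r⇒p≤r-q {p} {q} {r} p+q≤r = subst (_≤ℚ r - q) (//-rightDividesʳ q p) (+-monoˡ-≤ (- q) p+q≤r)

m<o∧o≤q⇒m≤q-1 : ∀ {m o q} → m < o → ℕ→ℚ o ≤ℚ q → ℕ→ℚ m ≤ℚ q - 1ℚ
m<o∧o≤q⇒m≤q-1 {m} m<o o≤q = p+q≤r⇒p≤r-q (subst (_≤ℚ _) (ℕ→ℚ-suc m) (≤-trans (ℕ→ℚ-mono-≤ m<o) o≤q))

w≤q-1∧x≤d+w⇒x≤d+q-1 : ∀ {w x d q} → ℕ→ℚ w ≤ℚ q - 1ℚ → x ≤ d ℕ.+ w → ℕ→ℚ x ≤ℚ ℕ→ℚ d + q - 1ℚ
w≤q-1∧x≤d+w⇒x≤d+q-1 {w} {x} {d} {q} w≤q-1 x≤d+w = begin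
  ℕ→ℚ x                 ≤⟨ ℕ→ℚ-mono-≤ x≤d+w ⟩
  ℕ→ℚ (d ℕ.+ w)         ≡⟨ ℕ→ℚ-homo-+ d w ⟩
  ℕ→ℚ d + ℕ→ℚ w         ≤⟨ +-monoʳ-≤ (ℕ→ℚ d) w≤q-1 ⟩
  ℕ→ℚ d + (q - 1ℚ)      ≡⟨ +-assoc (ℕ→ℚ d) q (- 1ℚ) ⟨
  ℕ→ℚ d + q - 1ℚ        ∎
  where open ≤-Reasoning

w≤q∧1+m≰q⇒w≤m : ∀ {w m q} → ℕ→ℚ w ≤ℚ q → ¬ ℕ→ℚ (suc m) ≤ℚ q → w ≤ m
w≤q∧1+m≰q⇒w≤m {w} {m} w≤q 1+m≰q with w ℕ.≤? m
... | yes w≤m = w≤m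
... | no w≰m = ⊥-elim (1+m≰q (≤-trans (ℕ→ℚ-mono-≤ (ℕ.≰⇒> w≰m)) w≤q))

q-t≮h⇒h+t≤q : ∀ {h t q} → ¬ (q - ℕ→ℚ t <ℚ ℕ→ℚ h) → ℕ→ℚ (h ℕ.+ t) ≤ℚ q
q-t≮h⇒h+t≤q {h} {t} q-t≮h = subst (_≤ℚ _) (sym (ℕ→ℚ-homo-+ h t)) (p≤r-q⇒p+q≤r (≮⇒≥ q-t≮h))

k≤[1+α]k : ∀ {α} k → 0ℚ ≤ℚ α → ℕ→ℚ k ≤ℚ (1ℚ + α) * ℕ→ℚ k
k≤[1+α]k {α} k 0≤α = begin
  ℕ→ℚ k                        ≡⟨ sym (trans (+-identityʳ _) (*-identityˡ _)) ⟩
  1ℚ * ℕ→ℚ k + 0ℚ              ≤⟨ +-monoʳ-≤ (1ℚ * ℕ→ℚ k) 0≤αk ⟩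
  1ℚ * ℕ→ℚ k + α * ℕ→ℚ k       ≡⟨ *-distribʳ-+ (ℕ→ℚ k) 1ℚ α ⟨
  (1ℚ + α) * ℕ→ℚ k             ∎
  where
  open ≤-Reasoning
  instance
    k-nonNeg : NonNegative (ℕ→ℚ k)
    k-nonNeg = nonNegative (ℕ→ℚ-mono-≤ {0} {k} z≤n)
  0≤αk : 0ℚ ≤ℚ α * ℕ→ℚ k
  0≤αk = subst (_≤ℚ α * ℕ→ℚ k) (*-zeroˡ (ℕ→ℚ k)) (*-monoʳ-≤-nonNeg (ℕ→ℚ k) 0≤α)

-- Counting in lists

module _ {A : Set} (_≟_ : DecidableEquality A) where

  unique-⊆⇒length≤ : ∀ {xs ys : List A} → Unique xs → xs ⊆ ys → length xs ≤ length ys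
  unique-⊆-∉⇒length< : ∀ {xs ys : List A} {y} → Unique xs → xs ⊆ ys → y ∈ ys → y ∉ xs → length xs < length ys

  unique-⊆⇒length≤ {[]} _ _ = z≤n
  unique-⊆⇒length≤ {x ∷ xs} (x∉xs ∷ xs!) xs⊆ys =
    unique-⊆-∉⇒length< xs! (xs⊆ys ∘ there) (xs⊆ys (here refl)) (λ x∈xs → All.lookup x∉xs x∈xs refl)

  unique-⊆-∉⇒length< {xs} {ys} {y} xs! xs⊆ys y∈ys y∉xs = begin-strict
    length xs                        ≤⟨ unique-⊆⇒length≤ xs! xs⊆ys-y ⟩
    length (filter (¬? ∘ (y ≟_)) ys) <⟨ filter-notAll (¬? ∘ (y ≟_)) ys (Any.map (λ { refl y≢y → y≢y refl }) y∈ys) ⟩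
    length ys                        ∎
    where
    open ℕ.≤-Reasoning
    xs⊆ys-y : xs ⊆ filter (¬? ∘ (y ≟_)) ys
    xs⊆ys-y z∈xs = ∈-filter⁺ (¬? ∘ (y ≟_)) (xs⊆ys z∈xs) (λ { refl → y∉xs z∈xs })

  missing-from-shorter : ∀ {xs ys : List A} → Unique xs → length ys < length xs → ∃[ x ] x ∈ xs × x ∉ ys
  missing-from-shorter {xs} {ys} xs! ys<xs with Any.any? (λ x → ¬? (Any.any? (x ≟_) ys)) xs
  ... | yes missing = find missing
  ... | no none = ⊥-elim (ℕ.<⇒≱ ys<xs (unique-⊆⇒length≤ xs! xs⊆ys))
    where
    xs⊆ys : xs ⊆ ys
    xs⊆ys x∈xs = decidable-stable (Any.any? (_ ≟_) ys) (λ x∉ys → none (lose x∈xs x∉ys))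

  length-deduplicate-mono : ∀ {xs ys : List A} → xs ⊆ ys →
                            length (deduplicate _≟_ xs) ≤ length (deduplicate _≟_ ys)
  length-deduplicate-mono {xs} xs⊆ys = unique-⊆⇒length≤ (deduplicate-! _≟_ xs)
    (λ z∈xs → ∈-deduplicate⁺ _≟_ (xs⊆ys (∈-deduplicate⁻ _≟_ xs z∈xs)))

  length-deduplicate-∷ : ∀ x xs → length (deduplicate _≟_ (x ∷ xs)) ≤ suc (length (deduplicate _≟_ xs))
  length-deduplicate-∷ x xs = s≤s (length-filter _ (deduplicate _≟_ xs))

length-[1…m] : ∀ m → length (map suc (upTo m)) ≡ m
length-[1…m] m = trans (length-map suc (upTo m)) (length-upTo m)

fresh-colour : (F : List ℕ) → ∃[ x ] (1 ≤ x × x ≤ suc (length F)) × x ∉ F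
fresh-colour F
  with missing-from-shorter ℕ._≟_ (Unique.map⁺ ℕ.suc-injective (Unique.upTo⁺ (suc (length F))))
         (subst (length F <_) (sym (length-[1…m] (suc (length F)))) (ℕ.n<1+n _))
... | x , x∈1…m , x∉F with ∈-map⁻ suc x∈1…m
...   | y , y∈upTo , refl = suc y , (s≤s z≤n , ∈-upTo⁻ y∈upTo) , x∉F

∉-++⁻ : ∀ {A : Set} {x : A} xs {ys} → x ∉ xs ++ ys → x ∉ xs × x ∉ ys
∉-++⁻ xs x∉ = x∉ ∘ ∈-++⁺ˡ , x∉ ∘ ∈-++⁺ʳ xs

length-filter-disjoint : ∀ {A : Set} {P Q : Pred A 0ℓ} (P? : Decidable P) (Q? : Decidable Q) →
  (∀ {x} → P x → Q x → ⊥) → ∀ xs → length (filter P? xs) ℕ.+ length (filter Q? xs) ≤ length xs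
length-filter-disjoint P? Q? P∩Q=∅ [] = z≤n
length-filter-disjoint P? Q? P∩Q=∅ (x ∷ xs) with ih ← length-filter-disjoint P? Q? P∩Q=∅ xs | P? x | Q? x
... | yes px | yes qx = ⊥-elim (P∩Q=∅ px qx)
... | yes _  | no _   = s≤s ih
... | no _   | yes _  = subst (_≤ suc (length xs)) (sym (ℕ.+-suc _ _)) (s≤s ih)
... | no _   | no _   = ℕ.m≤n⇒m≤1+n ih

module _ {V : Set} (_≟_ : DecidableEquality V) (Good : V → ℕ → Set) where

  record InjectiveChoice (vs : List V) : Set where
    field
      choice    : V → ℕ
      good      : ∀ {v} → v ∈ vs → Good v (choice v)
      injective : ∀ {v w} → v ∈ vs → w ∈ vs → choice v ≡ choice w → v ≡ w

  empty-choice : InjectiveChoice []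
  empty-choice = record { choice = λ _ → 0 ; good = λ () ; injective = λ () }

  choice-∷ : ∀ {v x vs} (f : InjectiveChoice vs) → Good v x → x ∉ map (InjectiveChoice.choice f) vs →
             InjectiveChoice (v ∷ vs)
  choice-∷ {v} {x} {vs} f gx x∉f[vs] = record { choice = g ; good = g-good ; injective = g-injective }
    where
    open InjectiveChoice f
    g : V → ℕ
    g w with w ≟ v
    ... | yes _ = x
    ... | no _  = choice w
    g-good : ∀ {w} → w ∈ v ∷ vs → Good w (g w)
    g-good {w} w∈v∷vs with w ≟ v | w∈v∷vs
    ... | yes refl | _          = gx
    ... | no w≢v   | here w≡v   = ⊥-elim (w≢v w≡v)
    ... | no _     | there w∈vs = good w∈vs
    x≢choice : ∀ {w} → w ∈ vs → x ≢ choice w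
    x≢choice w∈vs x≡fw = x∉f[vs] (subst (_∈ _) (sym x≡fw) (∈-map⁺ choice w∈vs))
    g-injective : ∀ {w w′} → w ∈ v ∷ vs → w′ ∈ v ∷ vs → g w ≡ g w′ → w ≡ w′
    g-injective {w} {w′} w∈ w′∈ gw≡gw′ with w ≟ v | w′ ≟ v | w∈ | w′∈
    ... | yes refl | yes refl | _          | _           = refl
    ... | yes refl | no _     | _          | here w′≡v   = sym w′≡v
    ... | yes refl | no _     | _          | there w′∈vs = ⊥-elim (x≢choice w′∈vs gw≡gw′)
    ... | no _     | yes refl | here w≡v   | _           = w≡v
    ... | no _     | yes refl | there w∈vs | _           = ⊥-elim (x≢choice w∈vs (sym gw≡gw′))
    ... | no w≢v   | _        | here w≡v   | _           = ⊥-elim (w≢v w≡v)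
    ... | no _     | no w′≢v  | _          | here w′≡v   = ⊥-elim (w′≢v w′≡v)
    ... | no _     | no _     | there w∈vs | there w′∈vs = injective w∈vs w′∈vs gw≡gw′

  extend-choice : ∀ xs {ys} → InjectiveChoice ys →
    (∀ {v} → v ∈ xs → (used : List ℕ) → length used < length xs ℕ.+ length ys → ∃[ x ] Good v x × x ∉ used) →
    InjectiveChoice (xs ++ ys)
  extend-choice []       f _     = f
  extend-choice (v ∷ xs) {ys} f avail =
    let x , gx , x∉used = avail (here refl) (map (InjectiveChoice.choice f′) (xs ++ ys)) used<
    in choice-∷ f′ gx x∉used
    where
    f′ : InjectiveChoice (xs ++ ys)
    f′ = extend-choice xs f (λ v∈xs used used< → avail (there v∈xs) used (ℕ.m≤n⇒m≤1+n used<))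
    used< : length (map (InjectiveChoice.choice f′) (xs ++ ys)) < suc (length xs ℕ.+ length ys)
    used< = s≤s (ℕ.≤-reflexive (trans (length-map _ (xs ++ ys)) (length-++ xs)))

module _ (G : Graph) where

  ∈-neighbours⁺ : ∀ {x y} → Adj G x y → y ∈ neighbours G x
  ∈-neighbours⁺ {x} {y} xy = ∈-filter⁺ (T? ∘ adj G x) (∈-allFin y) xy

  ∈-neighbours⁻ : ∀ {x y} → y ∈ neighbours G x → Adj G x y
  ∈-neighbours⁻ {x} y∈ = proj₂ (∈-filter⁻ (T? ∘ adj G x) {xs = allFin (n G)} y∈)

  neighbours-unique : ∀ x → Unique (neighbours G x)
  neighbours-unique x = Unique.filter⁺ (T? ∘ adj G x) (Unique.allFin⁺ (n G))

  Adj-sym : ∀ {x y} → Adj G x y → Adj G y x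
  Adj-sym {x} {y} = subst T (Graph.sym G x y)

  Adj-irrefl : ∀ {x y} → Adj G x y → x ≢ y
  Adj-irrefl {x} xx refl = subst T (irrefl G x) xx

  degree-0⇒¬Adj : ∀ {x y} → degree G x ≡ 0 → ¬ Adj G x y
  degree-0⇒¬Adj d≡0 xy = ℕ.<⇒≢ (∈-length (∈-neighbours⁺ xy)) (sym d≡0)

  degree-suc⇒∃Adj : ∀ {x m} → degree G x ≡ suc m → ∃[ y ] Adj G x y
  degree-suc⇒∃Adj d≡1+m = let y , y∈ = nonempty d≡1+m in y , ∈-neighbours⁻ y∈
    where
    nonempty : ∀ {A : Set} {ys : List A} {m} → length ys ≡ suc m → ∃[ y ] y ∈ ys
    nonempty {ys = y ∷ _} _ = y , here refl

strongColours : (G : Graph) → Colouring G → Fin (n G) → List ℕ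
strongColours G c v = map (c v) (neighbours G v)

module _ (G : Graph) (c : Colouring G) where

  length-strongColours : ∀ v → length (strongColours G c v) ≡ degree G v
  length-strongColours v = length-map (c v) (neighbours G v)

  ∈-strongColours⁺ : ∀ {v y} → Adj G v y → c v y ∈ strongColours G c v
  ∈-strongColours⁺ vy = ∈-map⁺ (c _) (∈-neighbours⁺ G vy)

  ∈-strongColours⁻ : ∀ {v x} → x ∈ strongColours G c v → ∃[ y ] Adj G v y × x ≡ c v y
  ∈-strongColours⁻ {v} x∈ = let y , y∈ , x≡cvy = ∈-map⁻ (c v) x∈ in y , ∈-neighbours⁻ G y∈ , x≡cvy

  ∈-weakColours⁺ : ∀ {v y} → Adj G y v → c y v ∈ weakColours G c v
  ∈-weakColours⁺ yv = ∈-map⁺ (λ z → c z _) (∈-neighbours⁺ G (Adj-sym G yv))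

  ∈-weakColours⁻ : ∀ {v x} → x ∈ weakColours G c v → ∃[ y ] Adj G y v × x ≡ c y v
  ∈-weakColours⁻ {v} x∈ =
    let y , y∈ , x≡cyv = ∈-map⁻ (λ y → c y v) x∈ in y , Adj-sym G (∈-neighbours⁻ G y∈) , x≡cyv

  numWeakColours≤degree : ∀ x → numWeakColours G c x ≤ degree G x
  numWeakColours≤degree x = ℕ.≤-trans (length-deduplicate ℕ._≟_ (weakColours G c x))
                                      (ℕ.≤-reflexive (length-map _ (neighbours G x)))

  module _ (H : Graph) (c′ : Colouring H) where

    numWeakColours-mono : ∀ {x y} → weakColours G c x ⊆ weakColours H c′ y →
                          numWeakColours G c x ≤ numWeakColours H c′ y
    numWeakColours-mono = length-deduplicate-mono ℕ._≟_

    numWeakColours-∷ : ∀ {x y z} → weakColours G c x ⊆ z ∷ weakColours H c′ y →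
                       numWeakColours G c x ≤ suc (numWeakColours H c′ y)
    numWeakColours-∷ {y = y} {z} ⊆z∷ =
      ℕ.≤-trans (length-deduplicate-mono ℕ._≟_ ⊆z∷) (length-deduplicate-∷ ℕ._≟_ z (weakColours H c′ y))

InRange : ℚ → ℕ → Set
InRange K x = 1 ≤ x × ℕ→ℚ x ≤ℚ K

IncAdjacent-sym : ∀ {G x x′ y y′} → IncAdjacent G x x′ y y′ → IncAdjacent G y y′ x x′
IncAdjacent-sym (inj₁ x≡y)                          = inj₁ (sym x≡y)
IncAdjacent-sym (inj₂ (inj₁ (inj₁ (x≡y , x′≡y′))))   = inj₂ (inj₁ (inj₁ (sym x≡y , sym x′≡y′)))
IncAdjacent-sym (inj₂ (inj₁ (inj₂ (x≡y′ , x′≡y))))   = inj₂ (inj₁ (inj₂ (sym x′≡y , sym x≡y′)))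
IncAdjacent-sym (inj₂ (inj₂ (inj₁ y≡x′)))            = inj₂ (inj₂ (inj₂ y≡x′))
IncAdjacent-sym (inj₂ (inj₂ (inj₂ x≡y′)))            = inj₂ (inj₂ (inj₁ x≡y′))

IncAdjacent-reflect : ∀ {G H} {f : Fin (n H) → Fin (n G)} → (∀ {p q} → f p ≡ f q → p ≡ q) →
  ∀ {p p′ q q′} → IncAdjacent G (f p) (f p′) (f q) (f q′) → IncAdjacent H p p′ q q′
IncAdjacent-reflect f-inj (inj₁ e)                    = inj₁ (f-inj e)
IncAdjacent-reflect f-inj (inj₂ (inj₁ (inj₁ (e , e′)))) = inj₂ (inj₁ (inj₁ (f-inj e , f-inj e′)))
IncAdjacent-reflect f-inj (inj₂ (inj₁ (inj₂ (e , e′)))) = inj₂ (inj₁ (inj₂ (f-inj e , f-inj e′)))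
IncAdjacent-reflect f-inj (inj₂ (inj₂ (inj₁ e)))        = inj₂ (inj₂ (inj₁ (f-inj e)))
IncAdjacent-reflect f-inj (inj₂ (inj₂ (inj₂ e)))        = inj₂ (inj₂ (inj₂ (f-inj e)))

degree-subgraph-≤ : ∀ {H G} (s : Subgraph H G) x → degree H x ≤ degree G (f s x)
degree-subgraph-≤ {H} {G} s x = subst (_≤ degree G (f s x)) (length-map (f s) (neighbours H x))
  (unique-⊆⇒length≤ Fin._≟_ (Unique.map⁺ (inj s _ _) (neighbours-unique H x)) f[N[x]]⊆N[fx])
  where
  f[N[x]]⊆N[fx] : ∀ {z} → z ∈ map (f s) (neighbours H x) → z ∈ neighbours G (f s x)
  f[N[x]]⊆N[fx] z∈ with ∈-map⁻ (f s) z∈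
  ... | y , y∈ , refl = ∈-neighbours⁺ G (edges s x y (∈-neighbours⁻ H y∈))

MaxDegreeAtMost-subgraph : ∀ {H G d} → Subgraph H G → MaxDegreeAtMost G d → MaxDegreeAtMost H d
MaxDegreeAtMost-subgraph s Δ≤d x = ℕ.≤-trans (degree-subgraph-≤ s x) (Δ≤d (f s x))

minimal⇒¬colouring-extends : ∀ {d k α G H} → MinimalInH d k α G → (s : Subgraph H G) → Proper s →
  let K = ℕ→ℚ d + (1ℚ + α) * ℕ→ℚ k - 1ℚ ; ℓ = (1ℚ + α) * ℕ→ℚ k - 1ℚ in
  ¬ (IncColourable H K ℓ → IncColourable G K ℓ)
minimal⇒¬colouring-extends ((Δ≤d , G-uncolourable) , minimal) s proper extends =
  minimal _ s proper (MaxDegreeAtMost-subgraph s Δ≤d , G-uncolourable ∘ extends)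

-- Deleting an isolated vertex

-- `Fin (n G)` is not syntactically a successor, so punchIn is wrapped for an arbitrary index.
punchIn′ : ∀ {N} → Fin N → Fin (ℕ.pred N) → Fin N
punchIn′ {suc _} = punchIn

punchIn′-injective : ∀ {N} (i : Fin N) {p q} → punchIn′ i p ≡ punchIn′ i q → p ≡ q
punchIn′-injective {suc _} i = Fin.punchIn-injective i _ _

punchIn′-≢ : ∀ {N} (i : Fin N) p → punchIn′ i p ≢ i
punchIn′-≢ {suc _} = Fin.punchInᵢ≢i

data Image {N} (i : Fin N) : Fin N → Set where
  image : ∀ p → Image i (punchIn′ i p)

image? : ∀ {N} (i : Fin N) {x} → x ≢ i → Image i x
image? {suc _} i x≢i = subst (Image i) (Fin.punchIn-punchOut (x≢i ∘ sym)) (image (punchOut (x≢i ∘ sym)))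

preimage : ∀ {N} {i : Fin N} {x} → Image i x → Fin (ℕ.pred N)
preimage (image p) = p

punchIn′-preimage : ∀ {N} {i : Fin N} {x} (im : Image i x) → punchIn′ i (preimage im) ≡ x
punchIn′-preimage (image p) = refl

module VertexDeletion (G : Graph) (u : Fin (n G)) where

  G-u : Graph
  G-u = record
    { n      = ℕ.pred (n G)
    ; adj    = λ p q → adj G (punchIn′ u p) (punchIn′ u q)
    ; sym    = λ p q → Graph.sym G (punchIn′ u p) (punchIn′ u q)
    ; irrefl = λ p → irrefl G (punchIn′ u p)
    }

  G-u⊆G : Subgraph G-u G
  G-u⊆G = record { f = punchIn′ u ; inj = λ _ _ → punchIn′-injective u ; edges = λ _ _ pq → pq }

  G-u⊂G : Proper G-u⊆G
  G-u⊂G = inj₁ (pred<N u)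
    where
    pred<N : ∀ {N} → Fin N → ℕ.pred N < N
    pred<N {suc N} _ = ℕ.n<1+n N

  module Isolated (u-isolated : degree G u ≡ 0) where

    Adj⇒≢u : ∀ {x y} → Adj G x y → x ≢ u
    Adj⇒≢u xy refl = degree-0⇒¬Adj G u-isolated xy

    lift : Colouring G-u → Colouring G
    lift c x y with x Fin.≟ u | y Fin.≟ u
    ... | no x≢u | no y≢u = c (preimage (image? u x≢u)) (preimage (image? u y≢u))
    ... | _      | _      = 0

    lift-punchIn : ∀ c p q → lift c (punchIn′ u p) (punchIn′ u q) ≡ c p q
    lift-punchIn c p q with punchIn′ u p Fin.≟ u | punchIn′ u q Fin.≟ u
    ... | yes pu≡u | _       = ⊥-elim (punchIn′-≢ u p pu≡u)
    ... | no _     | yes qu≡u = ⊥-elim (punchIn′-≢ u q qu≡u)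
    ... | no p≢u   | no q≢u  =
      cong₂ c (punchIn′-injective u (punchIn′-preimage (image? u p≢u)))
              (punchIn′-injective u (punchIn′-preimage (image? u q≢u)))

    lift-proper : ∀ {c} → IsIncidenceColouring G-u c → IsIncidenceColouring G (lift c)
    lift-proper {c} proper x x′ y y′ xx′ yy′ ≠ adjacent
      with image? u (Adj⇒≢u xx′) | image? u (Adj⇒≢u (Adj-sym G xx′))
         | image? u (Adj⇒≢u yy′) | image? u (Adj⇒≢u (Adj-sym G yy′))
    ... | image p | image p′ | image q | image q′ =
      subst₂ _≢_ (sym (lift-punchIn c p p′)) (sym (lift-punchIn c q q′))
        (proper p p′ q q′ xx′ yy′ (λ (p≡q , p′≡q′) → ≠ (cong (punchIn′ u) p≡q , cong (punchIn′ u) p′≡q′))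
          (IncAdjacent-reflect {G} {G-u} (punchIn′-injective u) adjacent))

    lift-edges : ∀ {c} (P : ℕ → Set) → (∀ p q → Adj G-u p q → P (c p q)) → ∀ x y → Adj G x y → P (lift c x y)
    lift-edges {c} P P-c x y xy with image? u (Adj⇒≢u xy) | image? u (Adj⇒≢u (Adj-sym G xy))
    ... | image p | image q = subst P (sym (lift-punchIn c p q)) (P-c p q xy)

    lift-weakColours : ∀ {c} p → weakColours G (lift c) (punchIn′ u p) ⊆ weakColours G-u c p
    lift-weakColours {c} p z∈ with ∈-map⁻ (λ y → lift c y (punchIn′ u p)) z∈
    ... | y , y∈ , refl with image? u (Adj⇒≢u (Adj-sym G (∈-neighbours⁻ G y∈)))
    ...   | image q =
      subst (_∈ _) (sym (lift-punchIn c q p)) (∈-weakColours⁺ G-u c (Adj-sym G (∈-neighbours⁻ G y∈)))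

    lift-colourable : ∀ {K ℓ} → 0ℚ ≤ℚ ℓ → IncColourable G-u K ℓ → IncColourable G K ℓ
    lift-colourable {K} {ℓ} 0≤ℓ (c , proper , range , weak) =
      lift c , lift-proper proper , lift-edges (InRange K) range , λ x → weak-at x (x Fin.≟ u)
      where
      weak-image : ∀ {x} → Image u x → ℕ→ℚ (numWeakColours G (lift c) x) ≤ℚ ℓ
      weak-image (image p) = ≤-trans (ℕ→ℚ-mono-≤ (numWeakColours-mono G (lift c) G-u c (lift-weakColours p))) (weak p)
      weak-at : ∀ x → Dec (x ≡ u) → ℕ→ℚ (numWeakColours G (lift c) x) ≤ℚ ℓ
      weak-at x (yes refl) =
        ≤-trans (ℕ→ℚ-mono-≤ (ℕ.≤-trans (numWeakColours≤degree G (lift c) u) (ℕ.≤-reflexive u-isolated))) 0≤ℓ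
      weak-at x (no x≢u) = weak-image (image? u x≢u)

-- Deleting the edges at a vertex

module EdgesAt (G : Graph) (u : Fin (n G)) where

  V : Set
  V = Fin (n G)

  -- Abstract, so that unification can recover x and y from `Adj G-E[u] x y`.
  abstract
    adj-E[u] : V → V → Bool
    adj-E[u] x y with x Fin.≟ u | y Fin.≟ u
    ... | no _ | no _ = adj G x y
    ... | _    | _    = false

    adj-E[u]-sym : ∀ x y → adj-E[u] x y ≡ adj-E[u] y x
    adj-E[u]-sym x y with x Fin.≟ u | y Fin.≟ u
    ... | yes _ | yes _ = refl
    ... | yes _ | no _  = refl
    ... | no _  | yes _ = refl
    ... | no _  | no _  = Graph.sym G x y

    adj-E[u]-irrefl : ∀ x → adj-E[u] x x ≡ false
    adj-E[u]-irrefl x with x Fin.≟ u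
    ... | yes _ = refl
    ... | no _  = irrefl G x

    E[u]⇒≢u : ∀ {x y} → T (adj-E[u] x y) → x ≢ u × y ≢ u
    E[u]⇒≢u {x} {y} xy with x Fin.≟ u | y Fin.≟ u
    ... | no x≢u | no y≢u = x≢u , y≢u

    E[u]⇒Adj : ∀ {x y} → T (adj-E[u] x y) → Adj G x y
    E[u]⇒Adj {x} {y} xy with x Fin.≟ u | y Fin.≟ u
    ... | no _ | no _ = xy

    Adj⇒E[u] : ∀ {x y} → Adj G x y → x ≢ u → y ≢ u → T (adj-E[u] x y)
    Adj⇒E[u] {x} {y} xy x≢u y≢u with x Fin.≟ u | y Fin.≟ u
    ... | yes x≡u | _       = ⊥-elim (x≢u x≡u)
    ... | no _    | yes y≡u = ⊥-elim (y≢u y≡u)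
    ... | no _    | no _    = xy

  G-E[u] : Graph
  G-E[u] = record { n = n G ; adj = adj-E[u] ; sym = adj-E[u]-sym ; irrefl = adj-E[u]-irrefl }

  G-E[u]⊆G : Subgraph G-E[u] G
  G-E[u]⊆G = record { f = λ x → x ; inj = λ _ _ x≡y → x≡y ; edges = λ _ _ → E[u]⇒Adj }

  G-E[u]⊂G : ∀ {v} → Adj G u v → Proper G-E[u]⊆G
  G-E[u]⊂G {v} uv = inj₂ (u , v , uv , λ uv′ → proj₁ (E[u]⇒≢u uv′) refl)

  degree-E[u]-< : ∀ {v} → Adj G u v → degree G-E[u] v < degree G v
  degree-E[u]-< {v} uv = unique-⊆-∉⇒length< Fin._≟_ (neighbours-unique G-E[u] v)
    (∈-neighbours⁺ G ∘ E[u]⇒Adj ∘ ∈-neighbours⁻ G-E[u] {v}) (∈-neighbours⁺ G (Adj-sym G uv))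
    (λ u∈ → proj₂ (E[u]⇒≢u {v} (∈-neighbours⁻ G-E[u] {v} u∈)) refl)

  data Incidence : V → V → Set where
    strong : ∀ {v} → Adj G u v → Incidence u v
    weak   : ∀ {v} → Adj G u v → Incidence v u
    inner  : ∀ {x y} → Adj G-E[u] x y → Incidence x y

  classify : ∀ {x y} → Adj G x y → Incidence x y
  classify {x} {y} xy with x Fin.≟ u | y Fin.≟ u
  ... | yes refl | _        = strong xy
  ... | no _     | yes refl = weak (Adj-sym G xy)
  ... | no x≢u   | no y≢u   = inner (Adj⇒E[u] xy x≢u y≢u)

  module Extension (c : Colouring G-E[u]) where

    -- a v and b v are the colours given to the incidences (u, uv) and (v, vu).
    record Admissible (K ℓ : ℚ) (a b : V → ℕ) : Set where
      field
        a-injective : ∀ {v w} → Adj G u v → Adj G u w → a v ≡ a w → v ≡ w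
        a≢b         : ∀ {v w} → Adj G u v → Adj G u w → a v ≢ b w
        a-range     : ∀ {v} → Adj G u v → InRange K (a v)
        b-range     : ∀ {v} → Adj G u v → InRange K (b v)
        a-strong    : ∀ {v} → Adj G u v → a v ∉ strongColours G-E[u] c v
        b-strong    : ∀ {v} → Adj G u v → b v ∉ strongColours G-E[u] c v
        b-weak      : ∀ {v} → Adj G u v → b v ∉ weakColours G-E[u] c v
        a-weak      : ∀ {v} → Adj G u v →
                      a v ∈ weakColours G-E[u] c v ⊎ ℕ→ℚ (suc (numWeakColours G-E[u] c v)) ≤ℚ ℓ

    module _ (a b : V → ℕ) where

      extend : Colouring G
      extend x y with x Fin.≟ u | y Fin.≟ u
      ... | yes _ | _     = a y
      ... | no _  | yes _ = b x
      ... | no _  | no _  = c x y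

      colour : ∀ {x y} → Incidence x y → ℕ
      colour (strong {v} _)    = a v
      colour (weak {v} _)      = b v
      colour (inner {x} {y} _) = c x y

      extend-colour : ∀ {x y} (i : Incidence x y) → extend x y ≡ colour i
      extend-colour (strong {v} _) with u Fin.≟ u
      ... | yes _  = refl
      ... | no u≢u = ⊥-elim (u≢u refl)
      extend-colour (weak {v} uv) with v Fin.≟ u | u Fin.≟ u
      ... | yes refl | _      = ⊥-elim (Adj-irrefl G uv refl)
      ... | no _     | yes _  = refl
      ... | no _     | no u≢u = ⊥-elim (u≢u refl)
      extend-colour (inner {x} {y} xy) with x Fin.≟ u | y Fin.≟ u | E[u]⇒≢u xy
      ... | yes x≡u | _       | x≢u , _ = ⊥-elim (x≢u x≡u)
      ... | no _    | yes y≡u | _ , y≢u = ⊥-elim (y≢u y≡u)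
      ... | no _    | no _    | _       = refl

      extend-weakColours : ∀ {x z} → x ≢ u → z ∈ weakColours G extend x →
                           (Adj G u x × z ≡ a x) ⊎ z ∈ weakColours G-E[u] c x
      extend-weakColours {x} x≢u z∈ with ∈-weakColours⁻ G extend z∈
      ... | y , yx , refl with classify yx
      ...   | strong ux = inj₁ (ux , extend-colour (strong ux))
      ...   | weak _    = ⊥-elim (x≢u refl)
      ...   | inner yx′ = inj₂ (subst (_∈ _) (sym (extend-colour (inner yx′))) (∈-weakColours⁺ G-E[u] c yx′))

    module _ {K ℓ : ℚ} {a b : V → ℕ} (ab : Admissible K ℓ a b) where

      open Admissible ab

      strong≢inner : ∀ {v y y′} → Adj G u v → Adj G-E[u] y y′ → IncAdjacent G u v y y′ → a v ≢ c y y′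
      strong≢inner uv yy′ (inj₂ (inj₂ (inj₁ refl))) av≡cvy′ =
        a-strong uv (subst (_∈ _) (sym av≡cvy′) (∈-strongColours⁺ G-E[u] c yy′))
      strong≢inner uv yy′ (inj₁ refl)                     _ = proj₁ (E[u]⇒≢u yy′) refl
      strong≢inner uv yy′ (inj₂ (inj₁ (inj₁ (refl , _)))) _ = proj₁ (E[u]⇒≢u yy′) refl
      strong≢inner uv yy′ (inj₂ (inj₁ (inj₂ (refl , _)))) _ = proj₂ (E[u]⇒≢u yy′) refl
      strong≢inner uv yy′ (inj₂ (inj₂ (inj₂ refl)))       _ = proj₂ (E[u]⇒≢u yy′) refl

      weak≢inner : ∀ {v y y′} → Adj G u v → Adj G-E[u] y y′ → IncAdjacent G v u y y′ → b v ≢ c y y′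
      weak≢inner uv yy′ (inj₁ refl) bv≡cvy′ =
        b-strong uv (subst (_∈ _) (sym bv≡cvy′) (∈-strongColours⁺ G-E[u] c yy′))
      weak≢inner uv yy′ (inj₂ (inj₂ (inj₂ refl))) bv≡cyv =
        b-weak uv (subst (_∈ _) (sym bv≡cyv) (∈-weakColours⁺ G-E[u] c yy′))
      weak≢inner uv yy′ (inj₂ (inj₁ (inj₁ (_ , refl)))) _ = proj₂ (E[u]⇒≢u yy′) refl
      weak≢inner uv yy′ (inj₂ (inj₁ (inj₂ (_ , refl)))) _ = proj₁ (E[u]⇒≢u yy′) refl
      weak≢inner uv yy′ (inj₂ (inj₂ (inj₁ refl)))       _ = proj₁ (E[u]⇒≢u yy′) refl

      weak-weak-¬IncAdjacent : ∀ {v w} → Adj G u v → Adj G u w → v ≢ w → ¬ IncAdjacent G v u w u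
      weak-weak-¬IncAdjacent uv uw v≢w (inj₁ v≡w)                     = v≢w v≡w
      weak-weak-¬IncAdjacent uv uw v≢w (inj₂ (inj₁ (inj₁ (v≡w , _)))) = v≢w v≡w
      weak-weak-¬IncAdjacent uv uw v≢w (inj₂ (inj₁ (inj₂ (v≡u , _)))) = Adj-irrefl G uv (sym v≡u)
      weak-weak-¬IncAdjacent uv uw v≢w (inj₂ (inj₂ (inj₁ w≡u)))       = Adj-irrefl G uw (sym w≡u)
      weak-weak-¬IncAdjacent uv uw v≢w (inj₂ (inj₂ (inj₂ v≡u)))       = Adj-irrefl G uv (sym v≡u)

      colour-distinct : IsIncidenceColouring G-E[u] c →
                        ∀ {x x′ y y′} (i : Incidence x x′) (j : Incidence y y′) → ¬ (x ≡ y × x′ ≡ y′) →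
                        IncAdjacent G x x′ y y′ → colour a b i ≢ colour a b j
      colour-distinct _ (strong uv) (strong uw) ≠ _  av≡aw = ≠ (refl , a-injective uv uw av≡aw)
      colour-distinct _ (strong uv) (weak uw)   _ _  = a≢b uv uw
      colour-distinct _ (strong uv) (inner yy′) _ ia = strong≢inner uv yy′ ia
      colour-distinct _ (weak uv)   (strong uw) _ _  = a≢b uw uv ∘ sym
      colour-distinct _ (weak uv)   (weak uw)   ≠ ia =
        ⊥-elim (weak-weak-¬IncAdjacent uv uw (λ v≡w → ≠ (v≡w , refl)) ia)
      colour-distinct _ (weak uv)   (inner yy′) _ ia = weak≢inner uv yy′ ia
      colour-distinct _ (inner xx′) (strong uw) _ ia = strong≢inner uw xx′ (IncAdjacent-sym {G} ia) ∘ sym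
      colour-distinct _ (inner xx′) (weak uw)   _ ia = weak≢inner uw xx′ (IncAdjacent-sym {G} ia) ∘ sym
      colour-distinct c-proper (inner xx′) (inner yy′) ≠ ia = c-proper _ _ _ _ xx′ yy′ ≠ ia

      colour-range : (∀ x y → Adj G-E[u] x y → InRange K (c x y)) →
                     ∀ {x y} (i : Incidence x y) → InRange K (colour a b i)
      colour-range _       (strong uv) = a-range uv
      colour-range _       (weak uv)   = b-range uv
      colour-range c-range (inner xy)  = c-range _ _ xy

      weak-count : (∀ x → ℕ→ℚ (numWeakColours G-E[u] c x) ≤ℚ ℓ) → ℕ→ℚ (degree G u) ≤ℚ ℓ →
                   ∀ x → ℕ→ℚ (numWeakColours G (extend a b) x) ≤ℚ ℓ
      weak-count c-weak t≤ℓ x = count x (x Fin.≟ u)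
        where
        count : ∀ x → Dec (x ≡ u) → ℕ→ℚ (numWeakColours G (extend a b) x) ≤ℚ ℓ
        count _ (yes refl) = ≤-trans (ℕ→ℚ-mono-≤ (numWeakColours≤degree G (extend a b) u)) t≤ℓ
        count x (no x≢u) = by-adjacency (T? (adj G u x))
          where
          only-old : weakColours G (extend a b) x ⊆ weakColours G-E[u] c x →
                     ℕ→ℚ (numWeakColours G (extend a b) x) ≤ℚ ℓ
          only-old ⊆old = ≤-trans (ℕ→ℚ-mono-≤ (numWeakColours-mono G (extend a b) G-E[u] c ⊆old)) (c-weak x)
          by-adjacency : Dec (Adj G u x) → ℕ→ℚ (numWeakColours G (extend a b) x) ≤ℚ ℓ
          by-adjacency (no ¬ux) = only-old ([ ⊥-elim ∘ ¬ux ∘ proj₁ , id ]′ ∘ extend-weakColours a b x≢u)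
          by-adjacency (yes ux) = [ a-old , a-new ]′ (a-weak ux)
            where
            a-old : a x ∈ weakColours G-E[u] c x → ℕ→ℚ (numWeakColours G (extend a b) x) ≤ℚ ℓ
            a-old a∈ = only-old ([ (λ { (_ , refl) → a∈ }) , id ]′ ∘ extend-weakColours a b x≢u)
            a-new : ℕ→ℚ (suc (numWeakColours G-E[u] c x)) ≤ℚ ℓ → ℕ→ℚ (numWeakColours G (extend a b) x) ≤ℚ ℓ
            a-new fits = ≤-trans (ℕ→ℚ-mono-≤ (numWeakColours-∷ G (extend a b) G-E[u] c
                                   ([ (λ { (_ , refl) → here refl }) , there ]′ ∘ extend-weakColours a b x≢u))) fits

    extend-colouring : ∀ {K ℓ a b} → IsIncColouringKL G-E[u] K ℓ c → Admissible K ℓ a b → ℕ→ℚ (degree G u) ≤ℚ ℓ →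
                       IsIncColouringKL G K ℓ (extend a b)
    extend-colouring {K} {a = a} {b} (c-proper , c-range , c-weak) ab t≤ℓ = proper , range , weak-count ab c-weak t≤ℓ
      where
      proper : IsIncidenceColouring G (extend a b)
      proper x x′ y y′ xx′ yy′ ≠ ia =
        subst₂ _≢_ (sym (extend-colour a b (classify xx′))) (sym (extend-colour a b (classify yy′)))
          (colour-distinct ab c-proper (classify xx′) (classify yy′) ≠ ia)
      range : ∀ x y → Adj G x y → InRange K (extend a b x y)
      range x y xy = subst (InRange K) (sym (extend-colour a b (classify xy))) (colour-range ab c-range (classify xy))

  module Choice (c : Colouring G-E[u]) {K ℓ : ℚ} {d k : ℕ}
    (Δ≤d : MaxDegreeAtMost G d) (t<k : suc (degree G u) ≤ k)
    (c-proper : IsIncidenceColouring G-E[u] c)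
    (c-range : ∀ x y → Adj G-E[u] x y → InRange K (c x y))
    (c-weak : ∀ x → ℕ→ℚ (numWeakColours G-E[u] c x) ≤ℚ ℓ)
    (in-range : ∀ {w x} → ℕ→ℚ w ≤ℚ ℓ → 1 ≤ x → x ≤ d ℕ.+ w → InRange K x)
    (t-fits : ℕ→ℚ (degree G u) ≤ℚ ℓ)
    (h+m-fits : ∀ {m} → m < degree G u → ℕ→ℚ (numHighNeighbours G d k u ℕ.+ m) ≤ℚ ℓ)
    where

    open Extension c
    open ℕ.≤-Reasoning

    N[u] : List V
    N[u] = neighbours G u

    t : ℕ
    t = degree G u

    S W : V → List ℕ
    S = strongColours G-E[u] c
    W v = deduplicate ℕ._≟_ (weakColours G-E[u] c v)

    Fits : ℕ → Set
    Fits w = ℕ→ℚ w ≤ℚ ℓ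

    Saturated : V → Set
    Saturated v = ¬ Fits (suc (length (W v)))

    -- The filter of numHighNeighbours, so that h is definitionally numHighNeighbours G d k u.
    High : V → Set
    High v = T ((d ℕ.+ 2) ℕ.≤ᵇ (degree G v ℕ.+ k))

    High? : ∀ v → Dec (High v)
    High? v = T? _

    h : ℕ
    h = length (filter High? N[u])

    suc-degree-E[u]≤d : ∀ {v} → v ∈ N[u] → suc (degree G-E[u] v) ≤ d
    suc-degree-E[u]≤d {v} v∈ = ℕ.≤-trans (degree-E[u]-< (∈-neighbours⁻ G v∈)) (Δ≤d v)

    low-degree : ∀ {v} → v ∈ N[u] → ¬ High v → suc (degree G-E[u] v) ℕ.+ t ≤ d
    low-degree {v} v∈ ¬high = ℕ.≤-pred (begin
      suc (suc (degree G-E[u] v) ℕ.+ t) ≡⟨ ℕ.+-suc _ t ⟨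
      suc (degree G-E[u] v) ℕ.+ suc t   ≤⟨ ℕ.+-mono-≤ (degree-E[u]-< (∈-neighbours⁻ G v∈)) t<k ⟩
      degree G v ℕ.+ k                  ≤⟨ not-high ⟩
      suc d                             ∎)
      where
      not-high : degree G v ℕ.+ k ≤ suc d
      not-high = ℕ.≤-pred (ℕ.≰⇒> (¬high ∘ ℕ.≤⇒≤ᵇ ∘ subst (_≤ degree G v ℕ.+ k) (ℕ.+-comm 2 d)))

    length-S++ : ∀ v xs → length (S v ++ xs) ≡ degree G-E[u] v ℕ.+ length xs
    length-S++ v xs = trans (length-++ (S v)) (cong (ℕ._+ length xs) (length-strongColours G-E[u] c v))

    saturated-≥ : ∀ {v m} → Saturated v → Fits m → m ≤ length (W v)
    saturated-≥ sat m-fits = w≤q∧1+m≰q⇒w≤m m-fits sat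

    W⁻ : ∀ {v x} → x ∈ W v → ∃[ y ] Adj G-E[u] y v × x ≡ c y v
    W⁻ x∈ = ∈-weakColours⁻ G-E[u] c (∈-deduplicate⁻ ℕ._≟_ _ x∈)

    W-range : ∀ {v x} → x ∈ W v → InRange K x
    W-range x∈ = let y , yv , x≡cyv = W⁻ x∈ in subst (InRange K) (sym x≡cyv) (c-range y _ yv)

    W∉S : ∀ {v x} → x ∈ W v → x ∉ S v
    W∉S {v} x∈W x∈S =
      let y , yv , x≡cyv = W⁻ x∈W
          y′ , vy′ , x≡cvy′ = ∈-strongColours⁻ G-E[u] c x∈S
      in c-proper y v v y′ yv vy′ (λ (y≡v , _) → Adj-irrefl G-E[u] yv y≡v)
           (inj₂ (inj₂ (inj₁ refl))) (trans (sym x≡cyv) x≡cvy′)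

    ValidA ValidB : V → ℕ → Set
    ValidA v x = InRange K x × x ∉ S v × (x ∈ W v ⊎ Fits (suc (length (W v))))
    ValidB v x = InRange K x × x ∉ S v × x ∉ W v

    b-high : V → ℕ
    b-high v = proj₁ (fresh-colour (S v ++ W v))

    b-high-valid : ∀ {v} → v ∈ N[u] → ValidB v (b-high v)
    b-high-valid {v} v∈ =
      let _ , (1≤x , x≤) , x∉ = fresh-colour (S v ++ W v)
      in in-range (c-weak v) 1≤x (begin
           _                                        ≤⟨ x≤ ⟩
           suc (length (S v ++ W v))                ≡⟨ cong suc (length-S++ v (W v)) ⟩
           suc (degree G-E[u] v) ℕ.+ length (W v)   ≤⟨ ℕ.+-monoˡ-≤ _ (suc-degree-E[u]≤d v∈) ⟩
           d ℕ.+ length (W v)                       ∎)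
         , ∉-++⁻ (S v) x∉

    B-high : List ℕ
    B-high = map b-high (filter High? N[u])

    length-B-high++ : ∀ used → length (B-high ++ used) ≡ h ℕ.+ length used
    length-B-high++ used = trans (length-++ B-high) (cong (ℕ._+ length used) (length-map b-high (filter High? N[u])))

    Good : V → ℕ → Set
    Good v x = x ∉ B-high × ValidA v x

    good-from-W : ∀ {v x} → x ∈ W v → x ∉ B-high → Good v x
    good-from-W x∈W x∉B = x∉B , W-range x∈W , W∉S x∈W , inj₁ x∈W

    SatLow : V → Set
    SatLow v = ¬ High v × Saturated v

    SatLow? : ∀ v → Dec (SatLow v)
    SatLow? v = ¬? (High? v) ×-dec ¬? (ℕ→ℚ (suc (length (W v))) ≤ℚ? ℓ)

    N-satLow N-rest : List V
    N-satLow = filter SatLow? N[u]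
    N-rest   = filter (¬? ∘ SatLow?) N[u]

    avail-satLow : ∀ {v} → v ∈ N-satLow → (used : List ℕ) → length used < length N-satLow ℕ.+ 0 →
                   ∃[ x ] Good v x × x ∉ used
    avail-satLow {v} v∈ used used< =
      let x , x∈W , x∉ = missing-from-shorter ℕ._≟_ (deduplicate-! ℕ._≟_ _) fewer
          x∉B , x∉used = ∉-++⁻ B-high x∉
      in x , good-from-W x∈W x∉B , x∉used
      where
      sat = proj₂ (proj₂ (∈-filter⁻ SatLow? {xs = N[u]} v∈))
      fewer : length (B-high ++ used) < length (W v)
      fewer = begin-strict
        length (B-high ++ used) ≡⟨ length-B-high++ used ⟩
        h ℕ.+ length used       <⟨ ℕ.+-monoʳ-< h (subst (length used <_) (ℕ.+-identityʳ _) used<) ⟩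
        h ℕ.+ length N-satLow   ≤⟨ length-filter-disjoint High? SatLow? (λ high (¬high , _) → ¬high high) N[u] ⟩
        t                       ≤⟨ saturated-≥ sat t-fits ⟩
        length (W v)            ∎

    avail-unsaturated : ∀ {v} → v ∈ N[u] → Fits (suc (length (W v))) → (used : List ℕ) → length used < t →
                        ∃[ x ] Good v x × x ∉ used
    avail-unsaturated {v} v∈ fits used used<t =
      let x , (1≤x , x≤) , x∉ = fresh-colour (S v ++ B-high ++ used)
          x∉S , x∉B++used = ∉-++⁻ (S v) x∉
          x∉B , x∉used = ∉-++⁻ B-high x∉B++used
      in x , (x∉B , in-range (h+m-fits used<t) 1≤x (ℕ.≤-trans x≤ bound) , x∉S , inj₂ fits) , x∉used
      where
      bound : suc (length (S v ++ B-high ++ used)) ≤ d ℕ.+ (h ℕ.+ length used)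
      bound = begin
        suc (length (S v ++ B-high ++ used))             ≡⟨ cong suc (length-S++ v (B-high ++ used)) ⟩
        suc (degree G-E[u] v) ℕ.+ length (B-high ++ used) ≤⟨ ℕ.+-monoˡ-≤ _ (suc-degree-E[u]≤d v∈) ⟩
        d ℕ.+ length (B-high ++ used)                    ≡⟨ cong (d ℕ.+_) (length-B-high++ used) ⟩
        d ℕ.+ (h ℕ.+ length used)                        ∎

    avail-saturated : ∀ {v} → v ∈ N[u] → High v → Saturated v → (used : List ℕ) → length used < t →
                      ∃[ x ] Good v x × x ∉ used
    avail-saturated {v} v∈ high sat used used<t =
      let x , x∈W , x∉F′ = missing-from-shorter ℕ._≟_ (deduplicate-! ℕ._≟_ _) fewer
          x∉B , x∉used = ∉-++⁻ B-high (x∉F′ ∘ λ x∈F → ∈-filter⁺ (_∈? W v) x∈F x∈W)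
      in x , good-from-W x∈W x∉B , x∉used
      where
      F′ : List ℕ
      F′ = filter (_∈? W v) (B-high ++ used)
      b∈B : b-high v ∈ B-high ++ used
      b∈B = ∈-++⁺ˡ (∈-map⁺ b-high (∈-filter⁺ High? v∈ high))
      b∉W : b-high v ∉ W v
      b∉W = proj₂ (proj₂ (b-high-valid v∈))
      fewer : length F′ < length (W v)
      fewer = begin-strict
        length F′               <⟨ filter-notAll (_∈? W v) (B-high ++ used) (Any.map (λ { refl → b∉W }) b∈B) ⟩
        length (B-high ++ used) ≡⟨ length-B-high++ used ⟩
        h ℕ.+ length used       ≤⟨ saturated-≥ sat (h+m-fits used<t) ⟩
        length (W v)            ∎

    avail-rest : ∀ {v} → v ∈ N-rest → (used : List ℕ) → length used < length N-rest ℕ.+ length (N-satLow ++ []) →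
                 ∃[ x ] Good v x × x ∉ used
    avail-rest {v} v∈ used used< = by-saturation (ℕ→ℚ (suc (length (W v))) ≤ℚ? ℓ) (High? v)
      where
      v∈N[u] = proj₁ (∈-filter⁻ (¬? ∘ SatLow?) {xs = N[u]} v∈)
      ¬satLow = proj₂ (∈-filter⁻ (¬? ∘ SatLow?) {xs = N[u]} v∈)
      used<t : length used < t
      used<t = ℕ.<-≤-trans used< (subst (λ l → length N-rest ℕ.+ l ≤ t) (sym (cong length (++-identityʳ N-satLow)))
                 (length-filter-disjoint (¬? ∘ SatLow?) SatLow? (λ ¬s s → ¬s s) N[u]))
      by-saturation : Dec (Fits (suc (length (W v)))) → Dec (High v) → ∃[ x ] Good v x × x ∉ used
      by-saturation (yes fits) _          = avail-unsaturated v∈N[u] fits used used<t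
      by-saturation (no sat)   (yes high) = avail-saturated v∈N[u] high sat used used<t
      by-saturation (no sat)   (no ¬high) = ⊥-elim (¬satLow (¬high , sat))

    -- Saturated low neighbours choose first: they must reuse one of their own weak colours, and at
    -- that point only B-high and the choices of the other saturated low neighbours are excluded.
    a-choice : InjectiveChoice Fin._≟_ Good (N-rest ++ N-satLow ++ [])
    a-choice = extend-choice Fin._≟_ Good N-rest
                 (extend-choice Fin._≟_ Good N-satLow (empty-choice Fin._≟_ Good) avail-satLow) avail-rest

    open InjectiveChoice a-choice using (good; injective)

    a : V → ℕ
    a = InjectiveChoice.choice a-choice

    ∈-chosen : ∀ {v} → v ∈ N[u] → v ∈ N-rest ++ N-satLow ++ []
    ∈-chosen {v} v∈ = by-satLow (SatLow? v)
      where
      by-satLow : Dec (SatLow v) → v ∈ N-rest ++ N-satLow ++ []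
      by-satLow (yes satLow) = ∈-++⁺ʳ N-rest (∈-++⁺ˡ (∈-filter⁺ SatLow? v∈ satLow))
      by-satLow (no ¬satLow) = ∈-++⁺ˡ (∈-filter⁺ (¬? ∘ SatLow?) v∈ ¬satLow)

    A : List ℕ
    A = map a N[u]

    b-low : V → ℕ
    b-low v = proj₁ (fresh-colour (S v ++ A ++ W v))

    b-low-valid : ∀ {v} → v ∈ N[u] → ¬ High v → ValidB v (b-low v) × b-low v ∉ A
    b-low-valid {v} v∈ ¬high =
      let _ , (1≤x , x≤) , x∉ = fresh-colour (S v ++ A ++ W v)
          x∉S , x∉A++W = ∉-++⁻ (S v) x∉
          x∉A , x∉W = ∉-++⁻ A x∉A++W
      in (in-range (c-weak v) 1≤x (ℕ.≤-trans x≤ bound) , x∉S , x∉W) , x∉A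
      where
      bound : suc (length (S v ++ A ++ W v)) ≤ d ℕ.+ length (W v)
      bound = begin
        suc (length (S v ++ A ++ W v))                 ≡⟨ cong suc (length-S++ v (A ++ W v)) ⟩
        suc (degree G-E[u] v) ℕ.+ length (A ++ W v)    ≡⟨ cong (suc (degree G-E[u] v) ℕ.+_) length-A++W ⟩
        suc (degree G-E[u] v) ℕ.+ (t ℕ.+ length (W v)) ≡⟨ ℕ.+-assoc (suc (degree G-E[u] v)) t _ ⟨
        suc (degree G-E[u] v) ℕ.+ t ℕ.+ length (W v)   ≤⟨ ℕ.+-monoˡ-≤ _ (low-degree v∈ ¬high) ⟩
        d ℕ.+ length (W v)                             ∎
        where
        length-A++W : length (A ++ W v) ≡ t ℕ.+ length (W v)
        length-A++W = trans (length-++ A) (cong (ℕ._+ length (W v)) (length-map a N[u]))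

    b-by : ∀ v → Dec (High v) → ℕ
    b-by v (yes _) = b-high v
    b-by v (no _)  = b-low v

    b : V → ℕ
    b v = b-by v (High? v)

    b-valid : ∀ {v} → v ∈ N[u] → ValidB v (b v)
    b-valid {v} v∈ = by-height (High? v)
      where
      by-height : (high? : Dec (High v)) → ValidB v (b-by v high?)
      by-height (yes _)    = b-high-valid v∈
      by-height (no ¬high) = proj₁ (b-low-valid v∈ ¬high)

    a≢b : ∀ {v w} → v ∈ N[u] → w ∈ N[u] → a v ≢ b w
    a≢b {v} {w} v∈ w∈ = by-height (High? w)
      where
      by-height : (high? : Dec (High w)) → a v ≢ b-by w high?
      by-height (yes high) av≡bw =
        proj₁ (good (∈-chosen v∈)) (subst (_∈ B-high) (sym av≡bw) (∈-map⁺ b-high (∈-filter⁺ High? w∈ high)))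
      by-height (no ¬high) av≡bw = proj₂ (b-low-valid w∈ ¬high) (subst (_∈ A) av≡bw (∈-map⁺ a v∈))

    admissible : Admissible K ℓ a b
    admissible = record
      { a-injective = λ uv uw → injective (∈-chosen (∈-neighbours⁺ G uv)) (∈-chosen (∈-neighbours⁺ G uw))
      ; a≢b         = λ uv uw → a≢b (∈-neighbours⁺ G uv) (∈-neighbours⁺ G uw)
      ; a-range     = λ uv → proj₁ (a-valid uv)
      ; b-range     = λ uv → proj₁ (b-valid (∈-neighbours⁺ G uv))
      ; a-strong    = λ uv → proj₁ (proj₂ (a-valid uv))
      ; b-strong    = λ uv → proj₁ (proj₂ (b-valid (∈-neighbours⁺ G uv)))
      ; b-weak      = λ uv → proj₂ (proj₂ (b-valid (∈-neighbours⁺ G uv))) ∘ ∈-deduplicate⁺ ℕ._≟_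
      ; a-weak      = λ uv → [ inj₁ ∘ ∈-deduplicate⁻ ℕ._≟_ _ , inj₂ ]′ (proj₂ (proj₂ (a-valid uv)))
      }
      where
      a-valid : ∀ {v} → Adj G u v → ValidA v (a v)
      a-valid uv = proj₂ (good (∈-chosen (∈-neighbours⁺ G uv)))

  extend-colourable : ∀ {K ℓ d k} → MaxDegreeAtMost G d → suc (degree G u) ≤ k →
    (∀ {w x} → ℕ→ℚ w ≤ℚ ℓ → 1 ≤ x → x ≤ d ℕ.+ w → InRange K x) → ℕ→ℚ (degree G u) ≤ℚ ℓ →
    (∀ {m} → m < degree G u → ℕ→ℚ (numHighNeighbours G d k u ℕ.+ m) ≤ℚ ℓ) →
    IncColourable G-E[u] K ℓ → IncColourable G K ℓ
  extend-colourable {d = d} {k} Δ≤d t<k in-range t-fits h+m-fits (c , c-ok@(c-proper , c-range , c-weak)) =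
    Extension.extend c a b , Extension.extend-colouring c c-ok admissible t-fits
    where open Choice c {d = d} {k} Δ≤d t<k c-proper c-range c-weak in-range t-fits h+m-fits

lemma1 : (d k : ℕ) (α : ℚ) → 0ℚ ≤ℚ α → (G : Graph) → MinimalInH d k α G →
    (u : Fin (n G)) → suc (degree G u) ≤ k →
    (1ℚ + α) * ℕ→ℚ k - ℕ→ℚ (degree G u) <ℚ ℕ→ℚ (numHighNeighbours G d k u)
lemma1 d k α 0≤α G G-min@((Δ≤d , _) , _) u t<k =
  decidable-stable (_ <? _) λ ¬claim → by-degree ¬claim (degree G u) refl
  where
  X = (1ℚ + α) * ℕ→ℚ k
  h = numHighNeighbours G d k u
  k≤X : ℕ→ℚ k ≤ℚ X
  k≤X = k≤[1+α]k k 0≤α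
  by-degree : ¬ (X - ℕ→ℚ (degree G u) <ℚ ℕ→ℚ h) → ∀ m → degree G u ≡ m → ⊥
  by-degree _ zero u-isolated =
    minimal⇒¬colouring-extends {d} {k} {α} G-min G-u⊆G G-u⊂G
      (lift-colourable (m<o∧o≤q⇒m≤q-1 (ℕ.<-≤-trans (s≤s z≤n) t<k) k≤X))
    where open VertexDeletion G u
          open Isolated u-isolated
  by-degree ¬claim (suc _) degree≡1+m =
    minimal⇒¬colouring-extends {d} {k} {α} G-min G-E[u]⊆G (G-E[u]⊂G (proj₂ (degree-suc⇒∃Adj G degree≡1+m)))
      (extend-colourable Δ≤d t<k
        (λ {w} {x} w-fits 1≤x x≤d+w → 1≤x , w≤q-1∧x≤d+w⇒x≤d+q-1 {w} {x} {d} w-fits x≤d+w)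
        (m<o∧o≤q⇒m≤q-1 t<k k≤X)
        (λ m<t → m<o∧o≤q⇒m≤q-1 (ℕ.+-monoʳ-< h m<t) (q-t≮h⇒h+t≤q {h} {degree G u} {X} ¬claim)))
    where open EdgesAt G u
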